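{- Let $A,B\in\mathrm{SL}^\pm_2(\mathbb{Z}_p)$ be such that $A\equiv B\pmod{p^k}$ for some $k\in\mathbb{N}$, i.e. every entry of $A-B$ has $p$-adic absolute value at most $p^{ -k}$. Then for every two points $\mathbf{w},\mathbf{v}\in\mathbf{P}^1(\mathbb{Q}_p)$ one has $$d(A\mathbf{w},\mathbf{v})\le\max\{d(B\mathbf{w},\mathbf{v}),p^{ -k}\}.$$
   Context: $p$ is a prime, $\mathbb{Z}_p$ the $p$-adic integers, $\mathrm{SL}^\pm_2(\mathbb{Z}_p)$ the $2\times 2$ matrices over $\mathbb{Z}_p$ with determinant $\pm1$, acting on column vectors in homogeneous coordinates. For $\mathbf{w}=(\omega_1,\omega_2)^T,\mathbf{v}=(\upsilon_1,\upsilon_2)^T$, $d(\mathbf{w},\mathbf{v})=\frac{|\omega_1\upsilon_2-\omega_2\upsilon_1|_p}{\max\{|\omega_1|_p,|\omega_2|_p\}\max\{|\upsilon_1|_p,|\upsilon_2|_p\}}$. -}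

module Defs where

open import Data.Nat using (ℕ; zero; suc; _+_; _^_; _≤_)
open import Data.Integer as ℤ using (ℤ; +_; -_)
open import Data.Integer.Divisibility using (_∣_)
open import Data.Product using (_×_; ∃; _,_)
open import Data.Sum using (_⊎_)
open import Relation.Nullary using (¬_)

-- The p-adic integers ℤ_p, as coherent sequences of integers:
-- seq n represents the residue of the p-adic integer modulo p^n,
-- and consecutive approximations agree modulo p^n.
record ℤₚ (p : ℕ) : Set where
  field
    seq : ℕ → ℤ
    coh : ∀ n → (+ (p ^ n)) ∣ (seq (suc n) ℤ.- seq n)
open ℤₚ public

Seq : Set
Seq = ℕ → ℤ

⟦_⟧ : ∀ {p} → ℤₚ p → Seq
⟦ x ⟧ = seq x

_⊕_ _⊖_ _⊗_ : Seq → Seq → Seq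
(x ⊕ y) n = x n ℤ.+ y n
(x ⊖ y) n = x n ℤ.- y n
(x ⊗ y) n = x n ℤ.* y n

const : ℤ → Seq
const c _ = c

-- |x|_p ≤ p^{-n}   (x ≡ 0 mod p^n)
AbsLe : (p : ℕ) → Seq → ℕ → Set
AbsLe p x n = (+ (p ^ n)) ∣ x n

_≈[_]_ : Seq → ℕ → Seq → Set
x ≈[ p ] y = ∀ n → AbsLe p (x ⊖ y) n

record Mat (p : ℕ) : Set where
  constructor mat
  field
    a11 a12 a21 a22 : ℤₚ p
open Mat public

record Vec2 (p : ℕ) : Set where
  constructor vec
  field
    c1 c2 : ℤₚ p
open Vec2 public

SVec : Set
SVec = Seq × Seq

⟦_⟧ᵥ : ∀ {p} → Vec2 p → SVec
⟦ v ⟧ᵥ = ⟦ c1 v ⟧ , ⟦ c2 v ⟧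

det : ∀ {p} → Mat p → Seq
det M = (⟦ a11 M ⟧ ⊗ ⟦ a22 M ⟧) ⊖ (⟦ a12 M ⟧ ⊗ ⟦ a21 M ⟧)

InSLpm : (p : ℕ) → Mat p → Set
InSLpm p M = (det M ≈[ p ] const (+ 1)) ⊎ (det M ≈[ p ] const (- (+ 1)))

CongMod : (p : ℕ) → Mat p → Mat p → ℕ → Set
CongMod p A B k =
  AbsLe p (⟦ a11 A ⟧ ⊖ ⟦ a11 B ⟧) k × AbsLe p (⟦ a12 A ⟧ ⊖ ⟦ a12 B ⟧) k ×
  AbsLe p (⟦ a21 A ⟧ ⊖ ⟦ a21 B ⟧) k × AbsLe p (⟦ a22 A ⟧ ⊖ ⟦ a22 B ⟧) k

_·_ : ∀ {p} → Mat p → Vec2 p → SVec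
M · w = ((⟦ a11 M ⟧ ⊗ ⟦ c1 w ⟧) ⊕ (⟦ a12 M ⟧ ⊗ ⟦ c2 w ⟧))
      , ((⟦ a21 M ⟧ ⊗ ⟦ c1 w ⟧) ⊕ (⟦ a22 M ⟧ ⊗ ⟦ c2 w ⟧))

-- max{|w₁|_p, |w₂|_p} = p^{-a}
MaxAbsExactly : (p : ℕ) → SVec → ℕ → Set
MaxAbsExactly p (w₁ , w₂) a =
  (AbsLe p w₁ a × AbsLe p w₂ a) × ¬ (AbsLe p w₁ (suc a) × AbsLe p w₂ (suc a))

-- w ≠ 0 (so that w represents a point of P¹(ℚ_p))
NonZeroV : (p : ℕ) → Vec2 p → Set
NonZeroV p w = ∃ λ n → ¬ (AbsLe p ⟦ c1 w ⟧ n × AbsLe p ⟦ c2 w ⟧ n)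

-- d(w, v) ≤ p^{-n}, where
-- d(w,v) = |w₁v₂ - w₂v₁|_p / (max{|w₁|_p,|w₂|_p} · max{|v₁|_p,|v₂|_p})
DistLe : (p : ℕ) → SVec → SVec → ℕ → Set
DistLe p (w₁ , w₂) (v₁ , v₂) n =
  ∀ a b → MaxAbsExactly p (w₁ , w₂) a → MaxAbsExactly p (v₁ , v₂) b →
    AbsLe p ((w₁ ⊗ v₂) ⊖ (w₂ ⊗ v₁)) (n + a + b)

-- d(x, y) ≤ max{ d(x', y'), p^{-k} }.  All distances lie in {0} ∪ {p^{-n} : n ∈ ℕ},
-- so this says: for every threshold p^{-n} ≥ p^{-k} (i.e. n ≤ k),
-- d(x',y') ≤ p^{-n} implies d(x,y) ≤ p^{-n}.
DistLeMax : (p : ℕ) → SVec → SVec → SVec → SVec → ℕ → Set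
DistLeMax p x y x' y' k = ∀ n → n ≤ k → DistLe p x' y' n → DistLe p x y n

{-# OPTIONS --safe #-}
module Submission where

open import Defs
open import Data.Nat using (ℕ)
open import Data.Nat.Primality using (Prime)

open import Data.Nat as ℕ using (suc; _≤_; _≤′_; ≤′-refl; ≤′-step)
import Data.Nat.Properties as ℕ
open import Data.Integer using (ℤ; +_; -_; _+_; _*_; _-_)
import Data.Integer.Properties as ℤ
open import Data.Integer.Divisibility.Signed
open import Data.Integer.Tactic.RingSolver using (solve-∀)
open import Data.Product using (_×_; _,_; proj₁; proj₂)
open import Data.Sum using (_⊎_; inj₁; inj₂)
open import Function.Bundles using (_⇔_; mk⇔; Equivalence)
open import Relation.Binary.PropositionalEquality using (_≡_; refl; sym; trans; cong; subst)

-- The numerator of d(Aw, v) is the cross product of Aw and v, which equals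
-- that of Bw and v plus the cross product of (A - B)w and v; the latter has absolute
-- value at most p^{-k} |w| |v|. A matrix whose determinant is a unit maps w to a vector
-- of the same max-norm (apply the adjugate), so |Aw| = |w| = |Bw|, and the ultrametric
-- inequality concludes. For a threshold p^{-n} with n ≤ k and exact norms p^{-a} = |Aw|,
-- p^{-b} = |v|, all of this is checked on the approximations at level N = n + a + b.

*-pres-∣ : ∀ {d e x y} → d ∣ x → e ∣ y → d * e ∣ x * y
*-pres-∣ {d} {y = y} d∣x e∣y = ∣-trans (*-monoʳ-∣ d e∣y) (*-monoˡ-∣ y d∣x)

_≡±1[mod_] : ℤ → ℤ → Set
u ≡±1[mod d ] = d ∣ u - + 1 ⊎ d ∣ u - - + 1

∣m*u⇒∣m : ∀ {d m u} → d ∣ m * u → u ≡±1[mod d ] → d ∣ m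
∣m*u⇒∣m {d} {m} {u} d∣mu (inj₁ d∣u-1) =
  subst (d ∣_) (minus-one m u) (∣m∣n⇒∣m-n d∣mu (∣n⇒∣m*n m d∣u-1))
  where
  minus-one : ∀ m u → m * u - m * (u - + 1) ≡ m
  minus-one = solve-∀
∣m*u⇒∣m {d} {m} {u} d∣mu (inj₂ d∣u+1) =
  subst (d ∣_) (plus-one m u) (∣m∣n⇒∣m-n (∣n⇒∣m*n m d∣u+1) d∣mu)
  where
  plus-one : ∀ m u → m * (u - - + 1) - m * u ≡ m
  plus-one = solve-∀

module _ {d : ℤ} (a b c e w₁ w₂ : ℤ)
         (d∣img₁ : d ∣ a * w₁ + b * w₂) (d∣img₂ : d ∣ c * w₁ + e * w₂) where

  ∣image⇒∣*det : d ∣ w₁ * (a * e - b * c) × d ∣ w₂ * (a * e - b * c)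
  ∣image⇒∣*det =
      subst (d ∣_) (adj₁ a b c e w₁ w₂) (∣m∣n⇒∣m-n (∣n⇒∣m*n e d∣img₁) (∣n⇒∣m*n b d∣img₂))
    , subst (d ∣_) (adj₂ a b c e w₁ w₂) (∣m∣n⇒∣m-n (∣n⇒∣m*n a d∣img₂) (∣n⇒∣m*n c d∣img₁))
    where
    adj₁ : ∀ a b c e w₁ w₂ → e * (a * w₁ + b * w₂) - b * (c * w₁ + e * w₂) ≡ w₁ * (a * e - b * c)
    adj₁ = solve-∀
    adj₂ : ∀ a b c e w₁ w₂ → a * (c * w₁ + e * w₂) - c * (a * w₁ + b * w₂) ≡ w₂ * (a * e - b * c)
    adj₂ = solve-∀

  ∣image⇒∣ : (a * e - b * c) ≡±1[mod d ] → d ∣ w₁ × d ∣ w₂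
  ∣image⇒∣ unit = ∣m*u⇒∣m (proj₁ ∣image⇒∣*det) unit , ∣m*u⇒∣m (proj₂ ∣image⇒∣*det) unit

cross-perturb : ∀ {d e f w₁ w₂ v₁ v₂} (a₁₁ a₁₂ a₂₁ a₂₂ b₁₁ b₁₂ b₂₁ b₂₂ : ℤ) →
  d ∣ a₁₁ - b₁₁ → d ∣ a₁₂ - b₁₂ → d ∣ a₂₁ - b₂₁ → d ∣ a₂₂ - b₂₂ →
  e ∣ w₁ → e ∣ w₂ → f ∣ v₁ → f ∣ v₂ →
  d * e * f ∣ (b₁₁ * w₁ + b₁₂ * w₂) * v₂ - (b₂₁ * w₁ + b₂₂ * w₂) * v₁ →
  d * e * f ∣ (a₁₁ * w₁ + a₁₂ * w₂) * v₂ - (a₂₁ * w₁ + a₂₂ * w₂) * v₁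
cross-perturb {d} {e} {f} {w₁} {w₂} {v₁} {v₂} a₁₁ a₁₂ a₂₁ a₂₂ b₁₁ b₁₂ b₂₁ b₂₂
              δ₁₁ δ₁₂ δ₂₁ δ₂₂ e∣w₁ e∣w₂ f∣v₁ f∣v₂ def∣crossB =
  subst (d * e * f ∣_) (sym (split a₁₁ a₁₂ a₂₁ a₂₂ b₁₁ b₁₂ b₂₁ b₂₂ w₁ w₂ v₁ v₂))
    (∣m∣n⇒∣m+n def∣crossB
      (∣m∣n⇒∣m-n (∣m∣n⇒∣m+n (term δ₁₁ e∣w₁ f∣v₂) (term δ₁₂ e∣w₂ f∣v₂))
                 (∣m∣n⇒∣m+n (term δ₂₁ e∣w₁ f∣v₁) (term δ₂₂ e∣w₂ f∣v₁))))
  where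
  term : ∀ {x y z} → d ∣ x → e ∣ y → f ∣ z → d * e * f ∣ x * y * z
  term d∣x e∣y f∣z = *-pres-∣ (*-pres-∣ d∣x e∣y) f∣z
  split : ∀ a₁₁ a₁₂ a₂₁ a₂₂ b₁₁ b₁₂ b₂₁ b₂₂ w₁ w₂ v₁ v₂ →
    (a₁₁ * w₁ + a₁₂ * w₂) * v₂ - (a₂₁ * w₁ + a₂₂ * w₂) * v₁ ≡
    ((b₁₁ * w₁ + b₁₂ * w₂) * v₂ - (b₂₁ * w₁ + b₂₂ * w₂) * v₁) +
    (((a₁₁ - b₁₁) * w₁ * v₂ + (a₁₂ - b₁₂) * w₂ * v₂) -
     ((a₂₁ - b₂₁) * w₁ * v₁ + (a₂₂ - b₂₂) * w₂ * v₁))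
  split = solve-∀

module Approximations (p : ℕ) where

  p^_ : ℕ → ℤ
  p^ m = + (p ℕ.^ m)

  p^-+ : ∀ m n → p^ (m ℕ.+ n) ≡ p^ m * p^ n
  p^-+ m n = trans (cong +_ (ℕ.^-distribˡ-+-* p m n)) (ℤ.pos-* (p ℕ.^ m) (p ℕ.^ n))

  p^-mono-∣ : ∀ {m n} → m ≤ n → p^ m ∣ p^ n
  p^-mono-∣ {m} m≤n with ℕ.m≤n⇒∃[o]m+o≡n m≤n
  ... | o , refl = subst (p^ m ∣_) (sym (p^-+ m o)) (∣m⇒∣m*n (p^ o) ∣-refl)

  AbsLe⇒∣ : ∀ s {n} → AbsLe p s n → p^ n ∣ s n
  AbsLe⇒∣ s = ∣ᵤ⇒∣

  ∣⇒AbsLe : ∀ s {n} → p^ n ∣ s n → AbsLe p s n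
  ∣⇒AbsLe s = ∣⇒∣ᵤ

  Coherent : Seq → Set
  Coherent s = ∀ {m n} → m ≤ n → p^ m ∣ s n - s m

  ⟦⟧-coherent : (x : ℤₚ p) → Coherent ⟦ x ⟧
  ⟦⟧-coherent x m≤n = go (ℕ.≤⇒≤′ m≤n)
    where
    go : ∀ {m n} → m ≤′ n → p^ m ∣ seq x n - seq x m
    go {m} ≤′-refl = subst (p^ m ∣_) (sym (ℤ.+-inverseʳ (seq x m))) (divides (+ 0) refl)
    go {m} (≤′-step {n} m≤′n) =
      subst (p^ m ∣_) (telescope (seq x (suc n)) (seq x n) (seq x m))
        (∣m∣n⇒∣m+n (∣-trans (p^-mono-∣ (ℕ.≤′⇒≤ m≤′n))
                            (∣ᵤ⇒∣ {i = seq x (suc n) - seq x n} (coh x n)))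
                   (go m≤′n))
      where
      telescope : ∀ a b c → (a - b) + (b - c) ≡ a - c
      telescope = solve-∀

  ⊖-coherent : ∀ s t → Coherent s → Coherent t → Coherent (s ⊖ t)
  ⊖-coherent s t s-coh t-coh {m} {n} m≤n =
    subst (p^ m ∣_) (regroup (s n) (s m) (t n) (t m)) (∣m∣n⇒∣m-n (s-coh m≤n) (t-coh m≤n))
    where
    regroup : ∀ a b c e → (a - b) - (c - e) ≡ (a - c) - (b - e)
    regroup = solve-∀

  coherent-∣-level : ∀ s {n M N} → Coherent s → n ≤ M → n ≤ N → p^ n ∣ s M → p^ n ∣ s N
  coherent-∣-level s {n} {M} {N} s-coh n≤M n≤N p^n∣sM =
    subst (p^ n ∣_) (regroup (s N) (s M) (s n))
      (∣m∣n⇒∣m+n (∣m∣n⇒∣m-n (s-coh n≤N) (s-coh n≤M)) p^n∣sM)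
    where
    regroup : ∀ a b c → (a - c) - (b - c) + b ≡ a
    regroup = solve-∀

  _×ᵥ_ : SVec → SVec → Seq
  (x₁ , x₂) ×ᵥ (y₁ , y₂) = (x₁ ⊗ y₂) ⊖ (x₂ ⊗ y₁)

  AbsLeᵥ : SVec → ℕ → Set
  AbsLeᵥ (x₁ , x₂) n = AbsLe p x₁ n × AbsLe p x₂ n

  InSLpm⇒det≡±1 : ∀ M → InSLpm p M → ∀ m → det M m ≡±1[mod p^ m ]
  InSLpm⇒det≡±1 M (inj₁ det≈1)  m = inj₁ (AbsLe⇒∣ (det M ⊖ const (+ 1)) (det≈1 m))
  InSLpm⇒det≡±1 M (inj₂ det≈-1) m = inj₂ (AbsLe⇒∣ (det M ⊖ const (- + 1)) (det≈-1 m))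

  ·-AbsLeᵥ⇔ : ∀ M → InSLpm p M → (w : Vec2 p) → ∀ m → AbsLeᵥ (M · w) m ⇔ AbsLeᵥ ⟦ w ⟧ᵥ m
  ·-AbsLeᵥ⇔ M M-unimodular w m = mk⇔ reflect preserve
    where
    reflect : AbsLeᵥ (M · w) m → AbsLeᵥ ⟦ w ⟧ᵥ m
    reflect (h₁ , h₂)
      with ∣image⇒∣ (seq (a11 M) m) (seq (a12 M) m) (seq (a21 M) m) (seq (a22 M) m)
                    (seq (c1 w) m) (seq (c2 w) m)
                    (AbsLe⇒∣ (proj₁ (M · w)) h₁) (AbsLe⇒∣ (proj₂ (M · w)) h₂)
                    (InSLpm⇒det≡±1 M M-unimodular m)
    ... | p^m∣w₁ , p^m∣w₂ = ∣⇒AbsLe ⟦ c1 w ⟧ p^m∣w₁ , ∣⇒AbsLe ⟦ c2 w ⟧ p^m∣w₂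
    preserve : AbsLeᵥ ⟦ w ⟧ᵥ m → AbsLeᵥ (M · w) m
    preserve (h₁ , h₂) =
        ∣⇒AbsLe (proj₁ (M · w)) (combination (a11 M) (a12 M))
      , ∣⇒AbsLe (proj₂ (M · w)) (combination (a21 M) (a22 M))
      where
      combination : ∀ x y → p^ m ∣ seq x m * seq (c1 w) m + seq y m * seq (c2 w) m
      combination x y = ∣m∣n⇒∣m+n (∣n⇒∣m*n (seq x m) (AbsLe⇒∣ ⟦ c1 w ⟧ h₁))
                                  (∣n⇒∣m*n (seq y m) (AbsLe⇒∣ ⟦ c2 w ⟧ h₂))

  ·-MaxAbsExactly⇔ : ∀ M → InSLpm p M → (w : Vec2 p) → ∀ a →
    MaxAbsExactly p (M · w) a ⇔ MaxAbsExactly p ⟦ w ⟧ᵥ a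
  ·-MaxAbsExactly⇔ M M-unimodular w a =
    mk⇔ (λ (le , ¬le) → to (at a) le , λ le′ → ¬le (from (at (suc a)) le′))
        (λ (le , ¬le) → from (at a) le , λ le′ → ¬le (to (at (suc a)) le′))
    where
    open Equivalence
    at : ∀ m → AbsLeᵥ (M · w) m ⇔ AbsLeᵥ ⟦ w ⟧ᵥ m
    at = ·-AbsLeᵥ⇔ M M-unimodular w

  ·-×ᵥ-perturb : ∀ A B (w v : Vec2 p) {k n a b} → n ≤ k → CongMod p A B k →
    AbsLeᵥ ⟦ w ⟧ᵥ a → AbsLeᵥ ⟦ v ⟧ᵥ b →
    AbsLe p ((B · w) ×ᵥ ⟦ v ⟧ᵥ) (n ℕ.+ a ℕ.+ b) → AbsLe p ((A · w) ×ᵥ ⟦ v ⟧ᵥ) (n ℕ.+ a ℕ.+ b)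
  ·-×ᵥ-perturb A B w v {k} {n} {a} {b} n≤k (A≈B₁₁ , A≈B₁₂ , A≈B₂₁ , A≈B₂₂)
               (w₁≤a , w₂≤a) (v₁≤b , v₂≤b) crossB≤ =
    ∣⇒AbsLe ((A · w) ×ᵥ ⟦ v ⟧ᵥ) (∣-trans (∣-reflexive (sym p^-split))
      (cross-perturb (at (a11 A)) (at (a12 A)) (at (a21 A)) (at (a22 A))
                     (at (a11 B)) (at (a12 B)) (at (a21 B)) (at (a22 B))
                     (entry (a11 A) (a11 B) A≈B₁₁) (entry (a12 A) (a12 B) A≈B₁₂)
                     (entry (a21 A) (a21 B) A≈B₂₁) (entry (a22 A) (a22 B) A≈B₂₂)
                     (lift (c1 w) a≤N w₁≤a) (lift (c2 w) a≤N w₂≤a)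
                     (lift (c1 v) b≤N v₁≤b) (lift (c2 v) b≤N v₂≤b)
                     (∣-trans (∣-reflexive p^-split) (AbsLe⇒∣ ((B · w) ×ᵥ ⟦ v ⟧ᵥ) crossB≤))))
    where
    N = n ℕ.+ a ℕ.+ b

    at : ℤₚ p → ℤ
    at x = seq x N

    p^-split : p^ n * p^ a * p^ b ≡ p^ N
    p^-split = sym (trans (p^-+ (n ℕ.+ a) b) (cong (_* p^ b) (p^-+ n a)))

    n≤N : n ≤ N
    n≤N = ℕ.≤-trans (ℕ.m≤m+n n a) (ℕ.m≤m+n (n ℕ.+ a) b)
    a≤N : a ≤ N
    a≤N = ℕ.≤-trans (ℕ.m≤n+m a n) (ℕ.m≤m+n (n ℕ.+ a) b)
    b≤N : b ≤ N
    b≤N = ℕ.m≤n+m b (n ℕ.+ a)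

    lift : ∀ (x : ℤₚ p) {m} → m ≤ N → AbsLe p ⟦ x ⟧ m → p^ m ∣ at x
    lift x m≤N h = coherent-∣-level ⟦ x ⟧ (⟦⟧-coherent x) ℕ.≤-refl m≤N (AbsLe⇒∣ ⟦ x ⟧ h)

    entry : ∀ (x y : ℤₚ p) → AbsLe p (⟦ x ⟧ ⊖ ⟦ y ⟧) k → p^ n ∣ at x - at y
    entry x y h =
      coherent-∣-level (⟦ x ⟧ ⊖ ⟦ y ⟧) (⊖-coherent ⟦ x ⟧ ⟦ y ⟧ (⟦⟧-coherent x) (⟦⟧-coherent y))
                       n≤k n≤N (∣-trans (p^-mono-∣ n≤k) (AbsLe⇒∣ (⟦ x ⟧ ⊖ ⟦ y ⟧) h))

lemma3 : (p : ℕ) → Prime p → (A B : Mat p) → InSLpm p A → InSLpm p B →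
    (k : ℕ) → CongMod p A B k →
    (w v : Vec2 p) → NonZeroV p w → NonZeroV p v →
    DistLeMax p (A · w) ⟦ v ⟧ᵥ (B · w) ⟦ v ⟧ᵥ k
lemma3 p _ A B A-unimodular B-unimodular k A≈B w v _ _ n n≤k distB a b ‖Aw‖≡a ‖v‖≡b =
  ·-×ᵥ-perturb A B w v n≤k A≈B (proj₁ ‖w‖≡a) (proj₁ ‖v‖≡b) (distB a b ‖Bw‖≡a ‖v‖≡b)
  where
  open Approximations p
  open Equivalence

  ‖w‖≡a : MaxAbsExactly p ⟦ w ⟧ᵥ a
  ‖w‖≡a = to (·-MaxAbsExactly⇔ A A-unimodular w a) ‖Aw‖≡a

  ‖Bw‖≡a : MaxAbsExactly p (B · w) a
  ‖Bw‖≡a = from (·-MaxAbsExactly⇔ B B-unimodular w a) ‖w‖≡a
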